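{- Let $k\ge 1$ and $n\ge 1$. Let $P_1=(a_1,\dots,a_n)$ be a $k$-Naples parking function, and let $d_1,\dots,d_n$ be the spots in which cars $c_1,\dots,c_n$ park under the $k$-Naples rule. Let $1\le i\le n$ and consider the $i$-filled parking preference $P_2=((p_1,\dots,p_i),(a_{i+1},\dots,a_n))$, where $p_j=d_j$ for all $j\le i$ except for exactly one index $l\le i$, for which $p_l<d_l$. Then $P_2$ is an $i$-filled $k$-Naples parking function.
   Context: There are $n$ parking spots $1,2,\dots,n$ on a one-way street and cars $c_1,\dots,c_n$ arrive in order. A parking preference of length $n$ is a sequence $(a_1,\dots,a_n)\in[n]^n$, $a_j$ being the preferred spot of car $c_j$. $k$-Naples rule: car $c_j$ parks in spot $a_j$ if it is empty; otherwise it checks spots $a_j-1,a_j-2,\dots,a_j-k$ (only those $\ge 1$) in this order and parks in the first empty one; if all of these are occupied, it drives forward from $a_j$ and parks in the first empty spot after $a_j$; if there is none, it fails to park. A parking preference is a $k$-Naples parking function if all cars park. An $i$-filled parking preference of length $n$ is an ordered pair $((p_1,\dots,p_i),(a_{i+1},\dots,a_n))$ of sequences in $[n]$, where $p_j$ is the spot in which car $c_j$ has already parked (so the $p_j$ are distinct spots, occupied at the start) and $a_j$ ($j>i$) is the preference of car $c_j$, which has yet to park. It is an $i$-filled $k$-Naples parking function if cars $c_{i+1},\dots,c_n$, arriving in order with spots $p_1,\dots,p_i$ already occupied, all park using the $k$-Naples rule. -}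

module Defs where

open import Data.Nat using (ℕ; zero; suc; _+_; _∸_; _<_; _<?_)
open import Data.Nat.Properties using (_≟_)
open import Data.List using (List; []; _∷_; _++_; applyUpTo; filter; map)
open import Data.List.Membership.DecPropositional _≟_ using (_∈?_)
open import Data.Vec using (Vec; []; _∷_)
open import Data.Maybe using (Maybe; just; nothing)
open import Data.Product using (∃)
open import Relation.Binary.PropositionalEquality using (_≡_)
open import Relation.Nullary using (yes; no)

-- Spots are the natural numbers 1..n.  An occupancy state is the list of
-- occupied spots.

firstFree : List ℕ → List ℕ → Maybe ℕ
firstFree occ [] = nothing
firstFree occ (s ∷ ss) with s ∈? occ
... | yes _ = firstFree occ ss
... | no  _ = just s

-- spots a-1, a-2, ..., a-k, keeping only those ≥ 1 (i.e. a - j with j < a)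
backwardSpots : ℕ → ℕ → List ℕ
backwardSpots k a = map (λ j → a ∸ j) (filter (λ j → j <? a) (applyUpTo suc k))

forwardSpots : ℕ → ℕ → List ℕ
forwardSpots n a = applyUpTo (λ j → a + suc j) (n ∸ a)

naplesSpot : (n k : ℕ) → List ℕ → ℕ → Maybe ℕ
naplesSpot n k occ a = firstFree occ (a ∷ backwardSpots k a ++ forwardSpots n a)

naplesRun : (n k : ℕ) → List ℕ → {m : ℕ} → Vec ℕ m → Maybe (Vec ℕ m)
naplesRun n k occ [] = just []
naplesRun n k occ (a ∷ as) with naplesSpot n k occ a
... | nothing = nothing
... | just d with naplesRun n k (d ∷ occ) as
...   | nothing = nothing
...   | just ds = just (d ∷ ds)

IsNaplesPF : (n k : ℕ) → Vec ℕ n → Set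
IsNaplesPF n k as = ∃ λ ds → naplesRun n k [] as ≡ just ds

IsFilledNaplesPF : (n k : ℕ) → {i m : ℕ} → Vec ℕ i → Vec ℕ m → Set
IsFilledNaplesPF n k ps as = ∃ λ es → naplesRun n k (Data.Vec.toList ps) as ≡ just es

-- Run the cars c_{i+1}, …, cₙ simultaneously on the occupied sets A = {d₁, …, dᵢ} of P₁ and
-- B = A with dₗ replaced by pₗ < dₗ. The invariant is that B equals A or arises from it by
-- moving one car from a spot d back to a free spot p < d. A car preferring a scans the
-- interval [max(1, a - k), n] in the fixed order a, a - 1, …, a - k, a + 1, …, n and takes
-- the first free spot, so on A and B it takes the same spot unless the A-car takes p or the
-- B-car takes d. In every case the invariant survives; the one inequality needed (the new
-- displaced spot lies above its replacement) follows from the shape of the scanning order.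
-- In particular a car parks on B whenever it parks on A.
module Submission where

open import Defs
open import Data.Nat using (ℕ; suc; _+_; _∸_; _≤_; _<_; _<?_; _≤?_; s≤s; z<s; s<s)
open import Data.Nat.Properties
open import Data.Fin using (Fin)
import Data.Fin.Properties as Fin
open import Data.List as List using (List; []; _∷_; applyUpTo)
open import Data.List.Membership.Propositional using (_∈_; _∉_)
open import Data.List.Membership.Propositional.Properties
  using (∈-map∘filter⁻; ∈-map∘filter⁺; ∈-applyUpTo⁻; ∈-applyUpTo⁺;
         ∈-++⁻; ∈-++⁺ˡ; ∈-++⁺ʳ)
open import Data.List.Membership.DecPropositional _≟_ using (_∈?_)
open import Data.List.Relation.Unary.Any using (here; there)
import Data.List.Relation.Unary.All as ListAll
open import Data.List.Relation.Unary.All.Properties using (all-filter) renaming (++⁺ to ListAll-++⁺)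
open import Data.List.Relation.Unary.AllPairs using (AllPairs; []; _∷_)
import Data.List.Relation.Unary.AllPairs.Properties as AllPairs
open import Data.List.Relation.Binary.BagAndSetEquality
  using (_∼[_]_; set; [_]-Equality; bag-=⇒; ↭⇒∼bag; ∷-cong)
import Data.List.Relation.Binary.Permutation.Propositional as ↭
open import Data.List.Relation.Binary.Permutation.Propositional.Properties using (↭-reverse)
open import Data.Vec using (Vec; []; _∷_; _++_; take; drop; lookup; toList)
open import Data.Vec.Relation.Unary.All as All using (All; []; _∷_)
open import Data.Vec.Relation.Unary.All.Properties using (lookup⁺; ++⁻)
open import Data.Vec.Relation.Unary.AllPairs using ([]; _∷_)
open import Data.Vec.Relation.Unary.Any using (index)
open import Data.Vec.Relation.Unary.Any.Properties using (lookup-index)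
open import Data.Vec.Membership.Propositional.Properties using (∈-lookup; ∈-toList⁺; ∈-toList⁻)
open import Data.Vec.Relation.Unary.Unique.Propositional using (Unique)
open import Data.Vec.Relation.Unary.Unique.Propositional.Properties using (lookup-injective)
open import Data.Maybe using (just)
open import Data.Maybe.Properties using (just-injective)
open import Data.Product using (∃; _×_; _,_; proj₁; proj₂)
open import Data.Sum using (_⊎_; inj₁; inj₂)
open import Function.Base using (_∘_)
open import Function.Bundles using (Equivalence; mk⇔)
open import Relation.Binary.Bundles using (Setoid)
open import Relation.Binary.Definitions using (Asymmetric; tri<; tri≈; tri>)
open import Relation.Binary.PropositionalEquality
open import Relation.Nullary using (yes; no; contradiction)

private
  variable
    a d i k m n p s t x y z : ℕ
    A B L occ occ′ xs ys : List ℕ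

module SetEq = Setoid ([ set ]-Equality ℕ)

∷-swap-∼ : x ∷ y ∷ xs ∼[ set ] y ∷ x ∷ xs
∷-swap-∼ {x} {y} = bag-=⇒ (↭⇒∼bag (↭.swap x y ↭.refl))

reverse-∼ : ∀ {ℓ} {X : Set ℓ} (xs : List X) → List.reverse xs ∼[ set ] xs
reverse-∼ xs = bag-=⇒ (↭⇒∼bag (↭-reverse xs))

∈-∷-∼ : x ∷ xs ∼[ set ] y ∷ ys → z ∈ x ∷ xs → z ≢ y → z ∈ ys
∈-∷-∼ x∷xs∼y∷ys z∈ z≢y with Equivalence.to x∷xs∼y∷ys z∈
... | here z≡y   = contradiction z≡y z≢y
... | there z∈ys = z∈ys

∉-∷ : x ≢ y → x ∉ ys → x ∉ y ∷ ys
∉-∷ x≢y _    (here x≡y)   = x≢y x≡y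
∉-∷ _   x∉ys (there x∈ys) = x∉ys x∈ys

∈-∉-≢ : x ∈ xs → y ∉ xs → x ≢ y
∈-∉-≢ x∈xs y∉xs refl = y∉xs x∈xs

allPairs-discharge : ∀ {P : ℕ → Set} {R : ℕ → ℕ → Set} →
                     ListAll.All P xs → AllPairs (λ x y → P y → R x y) xs → AllPairs R xs
allPairs-discharge ListAll.[]          []         = []
allPairs-discharge (_ ListAll.∷ Pxs)  (Rx ∷ Rxs) =
  ListAll.zipWith (λ (Py , R[Py]) → R[Py] Py) (Pxs , Rx) ∷ allPairs-discharge Pxs Rxs

firstFree-sound : ∀ occ L → firstFree occ L ≡ just s → s ∈ L × s ∉ occ
firstFree-sound occ (x ∷ L) eq with x ∈? occ
... | yes _ = let s∈L , s∉occ = firstFree-sound occ L eq in there s∈L , s∉occ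
... | no x∉occ with refl ← just-injective eq = here refl , x∉occ

firstFree-complete : x ∈ L → x ∉ occ → ∃ λ s → firstFree occ L ≡ just s
firstFree-complete {L = y ∷ L} {occ} x∈L x∉occ with y ∈? occ
firstFree-complete (here refl) x∉occ | yes x∈occ = contradiction x∈occ x∉occ
firstFree-complete (there x∈L) x∉occ | yes _     = firstFree-complete x∈L x∉occ
... | no _ = y , refl

firstFree-cong : occ ∼[ set ] occ′ → ∀ L → firstFree occ L ≡ firstFree occ′ L
firstFree-cong same [] = refl
firstFree-cong {occ} {occ′} same (x ∷ L) with x ∈? occ | x ∈? occ′
... | yes _  | yes _  = firstFree-cong same L
... | no _   | no _   = refl
... | yes x∈ | no x∉  = contradiction (Equivalence.to same x∈) x∉
... | no x∉  | yes x∈ = contradiction (Equivalence.from same x∈) x∉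

firstFree-minimal : ∀ {R : ℕ → ℕ → Set} → Asymmetric R → AllPairs R L →
                    firstFree occ L ≡ just s → x ∈ L → R x s → x ∈ occ
firstFree-minimal {L = y ∷ L} {occ} {R = R} asym (y<L ∷ sorted) eq x∈L x<s with y ∈? occ
firstFree-minimal asym _            _  (here refl) _   | yes x∈occ = x∈occ
firstFree-minimal asym (_ ∷ sorted) eq (there x∈L) x<s | yes _     =
  firstFree-minimal asym sorted eq x∈L x<s
... | no _ with refl ← just-injective eq = contradiction (s<x x∈L x<s) (asym x<s)
  where
  s<x : ∀ {x} → x ∈ y ∷ L → R x y → R y x
  s<x (here refl) y<y = y<y
  s<x (there x∈L) _   = ListAll.lookup y<L x∈L

-- Precedes a x y: a car preferring a tries x before y (order a, a - 1, a - 2, …, a + 1, a + 2, …).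
data Precedes (a : ℕ) : ℕ → ℕ → Set where
  backward         : y < x → x ≤ a → Precedes a x y
  backward-forward : x ≤ a → a < y → Precedes a x y
  forward          : a < x → x < y → Precedes a x y

precedes-asym : Asymmetric (Precedes a)
precedes-asym (backward y<x _)         (backward x<y _)         = <-asym y<x x<y
precedes-asym (backward _ x≤a)         (backward-forward _ a<x) = <⇒≱ a<x x≤a
precedes-asym (backward _ x≤a)         (forward a<y y<x)        = <⇒≱ (<-trans a<y y<x) x≤a
precedes-asym (backward-forward _ a<y) (backward _ y≤a)         = <⇒≱ a<y y≤a
precedes-asym (backward-forward _ a<y) (backward-forward y≤a _) = <⇒≱ a<y y≤a
precedes-asym (backward-forward x≤a _) (forward a<y y<x)        = <⇒≱ (<-trans a<y y<x) x≤a
precedes-asym (forward a<x x<y)        (backward _ y≤a)         = <⇒≱ (<-trans a<x x<y) y≤a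
precedes-asym (forward a<x x<y)        (backward-forward y≤a _) = <⇒≱ (<-trans a<x x<y) y≤a
precedes-asym (forward _ x<y)          (forward _ y<x)          = <-asym x<y y<x

precedes-total : ∀ a → x ≢ y → Precedes a x y ⊎ Precedes a y x
precedes-total {x} {y} a x≢y with x ≤? a | y ≤? a | <-cmp x y
... | _       | _       | tri≈ _ x≡y _ = contradiction x≡y x≢y
... | yes _   | yes y≤a | tri< x<y _ _ = inj₂ (backward x<y y≤a)
... | yes x≤a | yes _   | tri> _ _ y<x = inj₁ (backward y<x x≤a)
... | yes x≤a | no y≰a  | _            = inj₁ (backward-forward x≤a (≰⇒> y≰a))
... | no x≰a  | yes y≤a | _            = inj₂ (backward-forward y≤a (≰⇒> x≰a))
... | no x≰a  | no _    | tri< x<y _ _ = inj₁ (forward (≰⇒> x≰a) x<y)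
... | no _    | no y≰a  | tri> _ _ y<x = inj₂ (forward (≰⇒> y≰a) y<x)

precedes-of-<-between : Precedes a d s → s < p → p < d → Precedes a p s
precedes-of-<-between (backward _ d≤a)           s<p p<d = backward s<p (≤-trans (<⇒≤ p<d) d≤a)
precedes-of-<-between (backward-forward d≤a a<s) s<p p<d =
  contradiction (<-trans a<s (<-trans s<p p<d)) (≤⇒≯ d≤a)
precedes-of-<-between (forward _ d<s)            s<p p<d = contradiction (<-trans s<p p<d) (<-asym d<s)

<-of-precedes-between : Precedes a p t → Precedes a t d → p < d → t < d
<-of-precedes-between (backward t<p _)         (backward d<t _)           p<d =
  contradiction (<-trans d<t t<p) (<-asym p<d)
<-of-precedes-between (backward-forward _ a<t) (backward _ t≤a)           _   =
  contradiction a<t (≤⇒≯ t≤a)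
<-of-precedes-between (forward a<p p<t)        (backward _ t≤a)           _   =
  contradiction (<-trans a<p p<t) (≤⇒≯ t≤a)
<-of-precedes-between _                        (backward-forward t≤a a<d) _   = ≤-<-trans t≤a a<d
<-of-precedes-between _                        (forward _ t<d)            _   = t<d

candidates : ℕ → ℕ → ℕ → List ℕ
candidates n k a = a ∷ backwardSpots k a List.++ forwardSpots n a

IsCandidate : ℕ → ℕ → ℕ → ℕ → Set
IsCandidate n k a x = 1 ≤ x × a ≤ x + k × x ≤ n

∈-backwardSpots⁻ : x ∈ backwardSpots k a → 1 ≤ x × x < a × a ≤ x + k
∈-backwardSpots⁻ {k = k} {a} x∈ with ∈-map∘filter⁻ (a ∸_) (_<? a) {xs = applyUpTo suc k} x∈
... | j , j∈ , refl , j<a with ∈-applyUpTo⁻ suc j∈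
...   | i , i<k , refl = m<n⇒0<n∸m j<a , ∸-monoʳ-< z<s (<⇒≤ j<a) , a≤x+k
  where
  a≤x+k : a ≤ a ∸ suc i + k
  a≤x+k = begin
    a                 ≡⟨ m∸n+n≡m (<⇒≤ j<a) ⟨
    a ∸ suc i + suc i ≤⟨ +-monoʳ-≤ (a ∸ suc i) i<k ⟩
    a ∸ suc i + k     ∎
    where open ≤-Reasoning

∈-backwardSpots⁺ : 1 ≤ x → x < a → a ≤ x + k → x ∈ backwardSpots k a
∈-backwardSpots⁺ {x} {k = k} 1≤x x<a a≤x+k with m≤n⇒∃[o]m+o≡n x<a
... | c , refl =
  ∈-map∘filter⁺ (suc x + c ∸_) (_<? suc x + c)
    (suc c , ∈-applyUpTo⁺ suc c<k , sym (m+n∸n≡m x c) , s≤s (+-monoˡ-≤ c 1≤x))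
  where
  c<k : c < k
  c<k = +-cancelˡ-≤ x (suc c) k (subst (_≤ x + k) (sym (+-suc x c)) a≤x+k)

∈-forwardSpots⁻ : a ≤ n → x ∈ forwardSpots n a → a < x × x ≤ n
∈-forwardSpots⁻ {a} {n} a≤n x∈ with ∈-applyUpTo⁻ (λ j → a + suc j) x∈
... | j , j<n∸a , refl = m<m+n a z<s , ≤-trans (+-monoʳ-≤ a j<n∸a) (≤-reflexive (m+[n∸m]≡n a≤n))

∈-forwardSpots⁺ : a < x → x ≤ n → x ∈ forwardSpots n a
∈-forwardSpots⁺ {a} {n = n} a<x x≤n with m≤n⇒∃[o]m+o≡n a<x
... | c , refl = subst (_∈ forwardSpots n a) (+-suc a c) (∈-applyUpTo⁺ (λ j → a + suc j) c<n∸a)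
  where
  c<n∸a : c < n ∸ a
  c<n∸a = ≤-trans (≤-reflexive (sym (m+n∸m≡n a (suc c))))
                  (∸-monoˡ-≤ a (subst (_≤ n) (sym (+-suc a c)) x≤n))

∈-candidates⁻ : 1 ≤ a → a ≤ n → x ∈ candidates n k a → IsCandidate n k a x
∈-candidates⁻ {a} {k = k} 1≤a a≤n (here refl) = 1≤a , m≤m+n a k , a≤n
∈-candidates⁻ {a} {k = k} 1≤a a≤n (there x∈) with ∈-++⁻ (backwardSpots k a) x∈
... | inj₁ x∈back = let 1≤x , x<a , a≤x+k = ∈-backwardSpots⁻ x∈back in
  1≤x , a≤x+k , ≤-trans (<⇒≤ x<a) a≤n
... | inj₂ x∈fwd = let a<x , x≤n = ∈-forwardSpots⁻ a≤n x∈fwd in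
  ≤-trans 1≤a (<⇒≤ a<x) , ≤-trans (<⇒≤ a<x) (m≤m+n _ k) , x≤n

∈-candidates⁺ : IsCandidate n k a x → x ∈ candidates n k a
∈-candidates⁺ {k = k} {a} {x} (1≤x , a≤x+k , x≤n) with <-cmp x a
... | tri< x<a _ _  = there (∈-++⁺ˡ (∈-backwardSpots⁺ 1≤x x<a a≤x+k))
... | tri≈ _ refl _ = here refl
... | tri> _ _ a<x  = there (∈-++⁺ʳ (backwardSpots k a) (∈-forwardSpots⁺ a<x x≤n))

isCandidate-≤ : IsCandidate n k a x → x ≤ y → y ≤ n → IsCandidate n k a y
isCandidate-≤ {k = k} (1≤x , a≤x+k , _) x≤y y≤n =
  ≤-trans 1≤x x≤y , ≤-trans a≤x+k (+-monoˡ-≤ k x≤y) , y≤n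

candidates-sorted : a ≤ n → AllPairs (Precedes a) (candidates n k a)
candidates-sorted {a} {n} {k} a≤n =
  ListAll-++⁺ (ListAll.tabulate λ x∈ → backward (below-a x∈) ≤-refl)
              (ListAll.tabulate λ x∈ → backward-forward ≤-refl (above-a x∈))
  ∷ AllPairs.++⁺ backward-sorted forward-sorted
      (ListAll.tabulate λ x∈ → ListAll.tabulate λ y∈ →
        backward-forward (<⇒≤ (below-a x∈)) (above-a y∈))
  where
  below-a : x ∈ backwardSpots k a → x < a
  below-a x∈ = proj₁ (proj₂ (∈-backwardSpots⁻ {k = k} x∈))
  above-a : x ∈ forwardSpots n a → a < x
  above-a x∈ = proj₁ (∈-forwardSpots⁻ a≤n x∈)
  backward-sorted : AllPairs (Precedes a) (backwardSpots k a)
  backward-sorted = AllPairs.map⁺ (allPairs-discharge (all-filter (_<? a) (applyUpTo suc k))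
    (AllPairs.filter⁺ (_<? a) (AllPairs.applyUpTo⁺₁ suc k λ {i} i<j _ j<a →
      backward (∸-monoʳ-< (s<s i<j) (<⇒≤ j<a)) (m∸n≤m a (suc i)))))
  forward-sorted : AllPairs (Precedes a) (forwardSpots n a)
  forward-sorted = AllPairs.applyUpTo⁺₁ (λ j → a + suc j) (n ∸ a) λ i<j _ →
    forward (m<m+n a z<s) (+-monoʳ-< a (s<s i<j))

-- In moved, B arises from A by moving the car in spot d to the free spot p < d.
data MovedBack (n : ℕ) (A B : List ℕ) : Set where
  identical : A ∼[ set ] B → MovedBack n A B
  moved     : p < d → d ≤ n → p ∉ A → d ∉ B → p ∷ A ∼[ set ] d ∷ B → MovedBack n A B

module _ {n k a d p : ℕ} {A B : List ℕ} (1≤a : 1 ≤ a) (a≤n : a ≤ n)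
         (p<d : p < d) (d≤n : d ≤ n) (p∉A : p ∉ A) (d∉B : d ∉ B) (A∼B : p ∷ A ∼[ set ] d ∷ B)
         where

  private
    ∈A⇒∈B : x ∈ A → x ≢ d → x ∈ B
    ∈A⇒∈B x∈A = ∈-∷-∼ A∼B (there x∈A)

    ∈B⇒∈A : x ∈ B → x ≢ p → x ∈ A
    ∈B⇒∈A x∈B = ∈-∷-∼ (SetEq.sym A∼B) (there x∈B)

    d∈A : d ∈ A
    d∈A = ∈-∷-∼ (SetEq.sym A∼B) (here refl) (>⇒≢ p<d)

    p∈B : p ∈ B
    p∈B = ∈-∷-∼ A∼B (here refl) (<⇒≢ p<d)

    sorted : AllPairs (Precedes a) (candidates n k a)
    sorted = candidates-sorted {k = k} a≤n

  module _ {s} (s-spot : naplesSpot n k A a ≡ just s) where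

    private
      s∈L : s ∈ candidates n k a
      s∈L = proj₁ (firstFree-sound A (candidates n k a) s-spot)

      s∉A : s ∉ A
      s∉A = proj₂ (firstFree-sound A (candidates n k a) s-spot)

      s-candidate : IsCandidate n k a s
      s-candidate = ∈-candidates⁻ 1≤a a≤n s∈L

      s-first : x ∈ candidates n k a → Precedes a x s → x ∈ A
      s-first = firstFree-minimal {occ = A} precedes-asym sorted s-spot

      s∉B : s ≢ p → s ∉ B
      s∉B s≢p s∈B = s∉A (∈B⇒∈A s∈B s≢p)

      d∈L : s ≡ p → d ∈ candidates n k a
      d∈L refl = ∈-candidates⁺ (isCandidate-≤ s-candidate (<⇒≤ p<d) d≤n)

    naplesSpot-moved-isJust : ∃ λ t → naplesSpot n k B a ≡ just t
    naplesSpot-moved-isJust with s ≟ p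
    ... | yes s≡p = firstFree-complete {occ = B} (d∈L s≡p) d∉B
    ... | no s≢p  = firstFree-complete {occ = B} s∈L (s∉B s≢p)

    module _ {t} (t-spot : naplesSpot n k B a ≡ just t) where

      private
        t∈L : t ∈ candidates n k a
        t∈L = proj₁ (firstFree-sound B (candidates n k a) t-spot)

        t∉B : t ∉ B
        t∉B = proj₂ (firstFree-sound B (candidates n k a) t-spot)

        t-first : x ∈ candidates n k a → Precedes a x t → x ∈ B
        t-first = firstFree-minimal {occ = B} precedes-asym sorted t-spot

        t≢p : t ≢ p
        t≢p = ∈-∉-≢ p∈B t∉B ∘ sym

        s≺t : t ≢ d → t ≢ s → Precedes a s t
        s≺t t≢d t≢s with precedes-total a t≢s
        ... | inj₁ t≺s = contradiction (∈A⇒∈B (s-first t∈L t≺s) t≢d) t∉B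
        ... | inj₂ s≺t = s≺t

        t≡s : s ≢ p → t ≢ d → t ≡ s
        t≡s s≢p t≢d with t ≟ s
        ... | yes t≡s = t≡s
        ... | no t≢s  = contradiction (∈B⇒∈A (t-first s∈L (s≺t t≢d t≢s)) s≢p) s∉A

        t<d : s ≡ p → t ≢ d → t < d
        t<d refl t≢d with precedes-total a t≢d
        ... | inj₁ t≺d = <-of-precedes-between (s≺t t≢d t≢p) t≺d p<d
        ... | inj₂ d≺t = contradiction (t-first (d∈L refl) d≺t) d∉B

        p<s : s ≢ p → t ≡ d → p < s
        p<s s≢p refl with precedes-total a (∈-∉-≢ d∈A s∉A) | <-cmp p s
        ... | inj₂ s≺d | _            = contradiction (t-first s∈L s≺d) (s∉B s≢p)
        ... | inj₁ _   | tri< p<s _ _ = p<s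
        ... | inj₁ _   | tri≈ _ p≡s _ = contradiction (sym p≡s) s≢p
        ... | inj₁ d≺s | tri> _ _ s<p = contradiction
          (s-first (∈-candidates⁺ (isCandidate-≤ s-candidate (<⇒≤ s<p) (≤-trans (<⇒≤ p<d) d≤n)))
                   (precedes-of-<-between d≺s s<p p<d))
          p∉A

      movedBack-step : MovedBack n (s ∷ A) (t ∷ B)
      movedBack-step with s ≟ p | t ≟ d
      ... | yes refl | yes refl = identical A∼B
      ... | yes refl | no t≢d   =
        moved (t<d refl t≢d) d≤n (∉-∷ t≢p (λ t∈A → t∉B (∈A⇒∈B t∈A t≢d))) (∉-∷ (≢-sym t≢d) d∉B)
              (SetEq.trans (∷-cong refl A∼B) ∷-swap-∼)
      ... | no s≢p   | yes refl =
        moved (p<s s≢p refl) (proj₂ (proj₂ s-candidate)) (∉-∷ (≢-sym s≢p) p∉A)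
              (∉-∷ (≢-sym (∈-∉-≢ d∈A s∉A)) (s∉B s≢p))
              (SetEq.trans ∷-swap-∼ (∷-cong refl A∼B))
      ... | no s≢p   | no t≢d   rewrite t≡s s≢p t≢d =
        moved p<d d≤n (∉-∷ (≢-sym s≢p) p∉A) (∉-∷ (∈-∉-≢ d∈A s∉A) d∉B)
              (SetEq.trans ∷-swap-∼ (SetEq.trans (∷-cong refl A∼B) ∷-swap-∼))

naplesSpot-movedBack : 1 ≤ a → a ≤ n → MovedBack n A B → naplesSpot n k A a ≡ just s →
                       ∃ λ t → naplesSpot n k B a ≡ just t × MovedBack n (s ∷ A) (t ∷ B)
naplesSpot-movedBack {a} {n} {k = k} {s = s} _ _ (identical A∼B) s-spot =
  s , trans (sym (firstFree-cong A∼B (candidates n k a))) s-spot , identical (∷-cong refl A∼B)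
naplesSpot-movedBack {k = k} 1≤a a≤n (moved p<d d≤n p∉A d∉B A∼B) s-spot
  with t , t-spot ← naplesSpot-moved-isJust {k = k} 1≤a a≤n p<d d≤n p∉A d∉B A∼B s-spot =
  t , t-spot , movedBack-step {k = k} 1≤a a≤n p<d d≤n p∉A d∉B A∼B s-spot t-spot

module _ (n k : ℕ) where

  Parks : List ℕ → Vec ℕ m → Set
  Parks occ as = ∃ λ ds → naplesRun n k occ as ≡ just ds

  naplesRun-∷⁻ : ∀ occ a (as : Vec ℕ m) {ds} → naplesRun n k occ (a ∷ as) ≡ just ds →
                 ∃ λ s → ∃ λ ds′ → naplesSpot n k occ a ≡ just s ×
                                   naplesRun n k (s ∷ occ) as ≡ just ds′ × ds ≡ s ∷ ds′
  naplesRun-∷⁻ occ a as run with naplesSpot n k occ a in s-spot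
  ... | just s with naplesRun n k (s ∷ occ) as in run′
  ...   | just ds′ = s , ds′ , refl , run′ , sym (just-injective run)

  naplesRun-∷⁺ : ∀ occ {as : Vec ℕ m} {ds} → naplesSpot n k occ a ≡ just s →
                 naplesRun n k (s ∷ occ) as ≡ just ds → naplesRun n k occ (a ∷ as) ≡ just (s ∷ ds)
  naplesRun-∷⁺ occ s-spot run rewrite s-spot | run = refl

  parks-movedBack : ∀ {as : Vec ℕ m} → All (λ a → 1 ≤ a × a ≤ n) as → MovedBack n A B →
                    Parks A as → Parks B as
  parks-movedBack []                  _  _ = [] , refl
  parks-movedBack {A = A} {B} {as = a ∷ as} ((1≤a , a≤n) ∷ bounded) AB (_ , run)
    with s , _ , s-spot , run′ , _ ← naplesRun-∷⁻ A a as run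
    with t , t-spot , AB′ ← naplesSpot-movedBack {k = k} 1≤a a≤n AB s-spot
    with es , run″ ← parks-movedBack bounded AB′ (_ , run′) = t ∷ es , naplesRun-∷⁺ B t-spot run″

  naplesRun-++⁻ : ∀ (xs : Vec ℕ i) {ys : Vec ℕ m} {ds} → naplesRun n k occ (xs ++ ys) ≡ just ds →
                  naplesRun n k occ xs ≡ just (take i ds) ×
                  naplesRun n k (List.reverseAcc occ (toList (take i ds))) ys ≡ just (drop i ds)
  naplesRun-++⁻ []                 run = refl , run
  naplesRun-++⁻ {occ = occ} (x ∷ xs) {ys} run
    with s , _ , s-spot , run′ , refl ← naplesRun-∷⁻ occ x (xs ++ ys) run
    with run₁ , run₂ ← naplesRun-++⁻ xs run′ = naplesRun-∷⁺ occ s-spot run₁ , run₂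

  naplesRun-fresh : ∀ occ (as : Vec ℕ m) {ds} → naplesRun n k occ as ≡ just ds → All (_∉ occ) ds
  naplesRun-fresh occ []       refl = []
  naplesRun-fresh occ (a ∷ as) run with s , _ , s-spot , run′ , refl ← naplesRun-∷⁻ occ a as run =
    proj₂ (firstFree-sound occ (candidates n k a) s-spot)
    ∷ All.map (_∘ there) (naplesRun-fresh (s ∷ occ) as run′)

  naplesRun-unique : ∀ occ (as : Vec ℕ m) {ds} → naplesRun n k occ as ≡ just ds → Unique ds
  naplesRun-unique occ []       refl = []
  naplesRun-unique occ (a ∷ as) run with s , _ , _ , run′ , refl ← naplesRun-∷⁻ occ a as run =
    All.map (λ d∉s∷occ s≡d → d∉s∷occ (here (sym s≡d))) (naplesRun-fresh (s ∷ occ) as run′)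
    ∷ naplesRun-unique (s ∷ occ) as run′

  naplesRun-≤ : ∀ occ {as : Vec ℕ m} {ds} → All (λ a → 1 ≤ a × a ≤ n) as →
                naplesRun n k occ as ≡ just ds → All (_≤ n) ds
  naplesRun-≤ occ [] refl = []
  naplesRun-≤ occ {a ∷ as} ((1≤a , a≤n) ∷ bounded) run
    with s , _ , s-spot , run′ , refl ← naplesRun-∷⁻ occ a as run =
    proj₂ (proj₂ (∈-candidates⁻ {k = k} 1≤a a≤n
      (proj₁ (firstFree-sound occ (candidates n k a) s-spot))))
    ∷ naplesRun-≤ (s ∷ occ) bounded run′

∈-toList⇒lookup : ∀ {v : Vec ℕ i} → x ∈ toList v → ∃ λ j → x ≡ lookup v j
∈-toList⇒lookup x∈ = let x∈v = ∈-toList⁻ x∈ in index x∈v , lookup-index x∈v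

lookup∈toList : ∀ (v : Vec ℕ i) j → lookup v j ∈ toList v
lookup∈toList v j = ∈-toList⁺ (∈-lookup j v)

lookup-∷-⊆ : ∀ (u v : Vec ℕ i) l → (∀ j → j ≢ l → lookup u j ≡ lookup v j) →
             x ∈ lookup v l ∷ toList u → x ∈ lookup u l ∷ toList v
lookup-∷-⊆ u v l _     (here refl) = there (lookup∈toList v l)
lookup-∷-⊆ u v l agree (there x∈u) with j , refl ← ∈-toList⇒lookup x∈u with j Fin.≟ l
... | yes refl = here refl
... | no j≢l   = there (subst (_∈ toList v) (sym (agree j j≢l)) (lookup∈toList v j))

lookup-∷-∼ : ∀ (u v : Vec ℕ i) l → (∀ j → j ≢ l → lookup u j ≡ lookup v j) →
             lookup v l ∷ toList u ∼[ set ] lookup u l ∷ toList v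
lookup-∷-∼ u v l agree =
  mk⇔ (lookup-∷-⊆ u v l agree) (lookup-∷-⊆ v u l (λ j j≢l → sym (agree j j≢l)))

movedBack-update : ∀ (u v : Vec ℕ i) l → Unique u → (∀ j → j ≢ l → lookup v j ≡ lookup u j) →
                   lookup v l < lookup u l → lookup u l ≤ n →
                   (∀ j → j ≢ l → lookup v l ≢ lookup v j) →
                   MovedBack n (toList u) (toList v)
movedBack-update u v l u-unique agree p<d d≤n p-new =
  moved p<d d≤n p∉u d∉v (lookup-∷-∼ u v l (λ j j≢l → sym (agree j j≢l)))
  where
  p∉u : lookup v l ∉ toList u
  p∉u p∈u with j , p≡uⱼ ← ∈-toList⇒lookup p∈u with j Fin.≟ l
  ... | yes refl = <⇒≢ p<d p≡uⱼ
  ... | no j≢l   = p-new j j≢l (trans p≡uⱼ (sym (agree j j≢l)))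
  d∉v : lookup u l ∉ toList v
  d∉v d∈v with j , d≡vⱼ ← ∈-toList⇒lookup d∈v with j Fin.≟ l
  ... | yes refl = >⇒≢ p<d d≡vⱼ
  ... | no j≢l   = j≢l (lookup-injective u-unique j l (sym (trans d≡vⱼ (agree j j≢l))))

lemma2p3 : (k i m : ℕ) → 1 ≤ k → 1 ≤ i →
           (as₁ : Vec ℕ i) (as₂ : Vec ℕ m) →
           All (λ a → 1 ≤ a × a ≤ i + m) (as₁ ++ as₂) →
           (ds : Vec ℕ (i + m)) → naplesRun (i + m) k [] (as₁ ++ as₂) ≡ just ds →
           (ps : Vec ℕ i) (l : Fin i) →
           (∀ j → j ≢ l → lookup ps j ≡ lookup (take i ds) j) →
           1 ≤ lookup ps l → lookup ps l < lookup (take i ds) l →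
           (∀ j → j ≢ l → lookup ps l ≢ lookup ps j) →
           IsFilledNaplesPF (i + m) k ps as₂
lemma2p3 k i m _ _ as₁ as₂ bounded ds run ps l agree _ p<d p-new
  with bounded₁ , bounded₂ ← ++⁻ as₁ bounded
  with run₁ , run₂ ← naplesRun-++⁻ (i + m) k {occ = []} as₁ run =
  parks-movedBack (i + m) k bounded₂ shifted
    (parks-movedBack (i + m) k bounded₂ (identical (reverse-∼ (toList (take i ds)))) (drop i ds , run₂))
  where
  shifted : MovedBack (i + m) (toList (take i ds)) (toList ps)
  shifted = movedBack-update (take i ds) ps l (naplesRun-unique (i + m) k [] as₁ run₁) agree p<d
              (lookup⁺ (naplesRun-≤ (i + m) k [] bounded₁ run₁) l) p-new
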